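{- Let $\mathcal{L}$ be a finite distributive lattice with set of join-irreducibles $J$ (convention below). Then $f(\delta)\ge |J|$ for every $\delta\in\mathcal{L}$.
   Context: For $\delta\in\mathcal{L}$, $f(\delta)$ is the number of elements of $\mathcal{L}$ comparable to $\delta$ (including $\delta$). $J$ is the set of join-irreducible elements of $\mathcal{L}$, with the minimum $\hat0$ counted as join-irreducible, so $|J|$ equals the number of elements in any maximal chain of $\mathcal{L}$. -}

module Defs where

open import Level using (Level; _⊔_)
open import Data.Nat using (ℕ)
open import Data.List using (List; length)
open import Data.List.Relation.Unary.All using (All)
open import Data.List.Relation.Unary.Any using (Any)
open import Data.List.Relation.Unary.AllPairs using (AllPairs)
open import Data.Product using (_×_; Σ)
open import Data.Sum using (_⊎_)
open import Relation.Nullary using (¬_)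
open import Relation.Binary.PropositionalEquality using (_≡_)
open import Relation.Binary.Lattice.Bundles using (DistributiveLattice)

module _ {c ℓ₁ ℓ₂ : Level} (L : DistributiveLattice c ℓ₁ ℓ₂) where
  open DistributiveLattice L

  record Enumerates {p : Level} (P : Carrier → Set p) (xs : List Carrier)
         : Set (c ⊔ ℓ₁ ⊔ p) where
    field
      sound    : All P xs
      complete : ∀ x → P x → Any (x ≈_) xs
      distinct : AllPairs (λ a b → ¬ (a ≈ b)) xs

  HasSize : {p : Level} → (Carrier → Set p) → ℕ → Set (c ⊔ ℓ₁ ⊔ p)
  HasSize P k = Σ (List Carrier) λ xs → Enumerates P xs × (length xs ≡ k)

  Finite : Set (c ⊔ ℓ₁)
  Finite = Σ (List Carrier) λ xs → ∀ x → Any (x ≈_) xs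

  IsMinimum : Carrier → Set (c ⊔ ℓ₂)
  IsMinimum z = ∀ x → z ≤ x

  -- join-irreducible, with the minimum 0̂ counted as join-irreducible:
  -- j is the minimum, or j is not the minimum and j = a ∨ b implies j = a or j = b.
  JoinIrreducible : Carrier → Set (c ⊔ ℓ₁ ⊔ ℓ₂)
  JoinIrreducible j =
    IsMinimum j ⊎
    ((¬ IsMinimum j) × (∀ a b → (a ∨ b) ≈ j → (a ≈ j) ⊎ (b ≈ j)))

  Comparable : Carrier → Carrier → Set ℓ₂
  Comparable x y = (x ≤ y) ⊎ (y ≤ x)

-- A join-irreducible element of a distributive lattice is join-prime: j ≤ a ∨ b
-- forces j ≤ a or j ≤ b.  Hence j ↦ j (if j ≤ δ) and j ↦ δ ∨ j (otherwise)
-- sends J injectively into the elements comparable to δ: two elements of the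
-- second kind with δ ∨ j = δ ∨ j' satisfy j ≤ j' and j' ≤ j, and an element of
-- the first kind lies below δ while one of the second kind does not.
-- Deciding j ≤ δ is not constructive, but the conclusion is a decidable
-- inequality of naturals, so the case split may be made under a double negation.
module Submission where

open import Defs
open import Level using (Level; _⊔_)
open import Data.Nat using (ℕ; _≥_)
open import Relation.Binary.Lattice.Bundles using (DistributiveLattice)
open DistributiveLattice using (Carrier)

open import Data.Nat as ℕ using (z≤n; s≤s)
open import Data.Nat.Properties using (module ≤-Reasoning)
open import Data.List using (List; []; _∷_; length)
open import Data.List.Properties using (length-removeAt′)
open import Data.List.Relation.Unary.All using (All; []; _∷_; reduce; zip)
open import Data.List.Relation.Unary.Any using (here; there)
open import Data.List.Relation.Unary.AllPairs using (AllPairs; []; _∷_)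
open import Data.List.Relation.Unary.Unique.Setoid using (Unique)
import Data.List.Membership.Setoid as Membership
open import Data.Product using (_×_; _,_)
open import Data.Sum as Sum using (_⊎_; inj₁; inj₂)
open import Relation.Binary.Bundles using (Setoid)
open import Relation.Binary.Core using (Rel)
open import Relation.Binary.PropositionalEquality using (_≡_; refl; cong)
open import Relation.Nullary using (¬_; Dec; yes; no; contradiction)
open import Relation.Nullary.Decidable using (decidable-stable; ¬¬-excluded-middle)
open import Relation.Nullary.Negation using (¬¬-map)
open import Relation.Unary using (Pred)
import Relation.Binary.Lattice.Properties.DistributiveLattice as DistributiveLatticeProperties
import Relation.Binary.Lattice.Properties.MeetSemilattice as MeetSemilatticeProperties
import Relation.Binary.Reasoning.Setoid as SetoidReasoning

private
  variable
    a p q r s : Level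
    A B : Set a

¬¬-decide-All : {P : Pred A p} (xs : List A) → ¬ ¬ All (λ x → Dec (P x)) xs
¬¬-decide-All []       k = k []
¬¬-decide-All (x ∷ xs) k =
  ¬¬-excluded-middle λ dx → ¬¬-decide-All xs λ dxs → k (dx ∷ dxs)

module Reduce {P : Pred A p} (f : ∀ {x} → P x → B) where

  length-reduce : ∀ {xs} (pxs : All P xs) → length (reduce f pxs) ≡ length xs
  length-reduce []        = refl
  length-reduce (_ ∷ pxs) = cong ℕ.suc (length-reduce pxs)

  All-reduce : {Q : Pred B q} → (∀ {x} (px : P x) → Q (f px)) →
               ∀ {xs} (pxs : All P xs) → All Q (reduce f pxs)
  All-reduce Qf []         = []
  All-reduce Qf (px ∷ pxs) = Qf px ∷ All-reduce Qf pxs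

  AllPairs-reduce : {R : Rel A r} {S : Rel B s} →
                    (∀ {x y} (px : P x) (py : P y) → R x y → S (f px) (f py)) →
                    ∀ {xs} (pxs : All P xs) → AllPairs R xs → AllPairs S (reduce f pxs)
  AllPairs-reduce Sf []         []        = []
  AllPairs-reduce {R = R} {S} Sf (px ∷ pxs) (Rxs ∷ Rpairs) =
    related pxs Rxs ∷ AllPairs-reduce Sf pxs Rpairs
    where
    related : ∀ {ys} (pys : All P ys) → All (R _) ys → All (S (f px)) (reduce f pys)
    related []         []           = []
    related (py ∷ pys) (Rxy ∷ Rxys) = Sf px py Rxy ∷ related pys Rxys

module _ (S : Setoid a r) where
  open Setoid S
  open Membership S using (_∈_; _─_)

  ∈-─ : ∀ {x y ys} (x∈ys : x ∈ ys) → y ∈ ys → ¬ y ≈ x → y ∈ ys ─ x∈ys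
  ∈-─ (here x≈z)   (here y≈z)   y≉x = contradiction (trans y≈z (sym x≈z)) y≉x
  ∈-─ (here _)     (there y∈ys) _   = y∈ys
  ∈-─ (there _)    (here y≈z)   _   = here y≈z
  ∈-─ (there x∈ys) (there y∈ys) y≉x = there (∈-─ x∈ys y∈ys y≉x)

  Unique-length≤ : ∀ {xs ys} → Unique S xs → All (_∈ ys) xs → length xs ℕ.≤ length ys
  Unique-length≤ {[]}         _               _               = z≤n
  Unique-length≤ {x ∷ xs} {ys} (x≉xs ∷ unique) (x∈ys ∷ xs⊆ys) = begin
    length (x ∷ xs)            ≤⟨ s≤s (Unique-length≤ unique (remaining x≉xs xs⊆ys)) ⟩
    ℕ.suc (length (ys ─ x∈ys)) ≡⟨ length-removeAt′ ys _ ⟨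
    length ys                  ∎
    where
    open ≤-Reasoning
    remaining : ∀ {zs} → All (λ z → ¬ x ≈ z) zs → All (_∈ ys) zs → All (_∈ ys ─ x∈ys) zs
    remaining []           []              = []
    remaining (x≉z ∷ x≉zs) (z∈ys ∷ zs⊆ys) =
      ∈-─ x∈ys z∈ys (λ z≈x → x≉z (sym z≈x)) ∷ remaining x≉zs zs⊆ys

module _ {c ℓ₁ ℓ₂} (L : DistributiveLattice c ℓ₁ ℓ₂) where
  open DistributiveLattice L renaming (Carrier to X; refl to ≤-refl)
  open DistributiveLatticeProperties L using (∧-distribʳ-∨)
  open MeetSemilatticeProperties meetSemilattice using (y≤x⇒x∧y≈y)

  JoinPrime : X → Set (c ⊔ ℓ₂)
  JoinPrime j = ∀ {x y} → j ≤ x ∨ y → j ≤ x ⊎ j ≤ y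

  joinIrreducible⇒joinPrime : ∀ {j} → JoinIrreducible L j → JoinPrime j
  joinIrreducible⇒joinPrime (inj₁ j-minimum) {x} _ = inj₁ (j-minimum x)
  joinIrreducible⇒joinPrime {j} (inj₂ (_ , irreducible)) {x} {y} j≤x∨y =
    Sum.map (below x) (below y) (irreducible (x ∧ j) (y ∧ j) j≈x∧j∨y∧j)
    where
    open SetoidReasoning setoid
    j≈x∧j∨y∧j : (x ∧ j) ∨ (y ∧ j) ≈ j
    j≈x∧j∨y∧j = begin
      (x ∧ j) ∨ (y ∧ j) ≈⟨ ∧-distribʳ-∨ j x y ⟨
      (x ∨ y) ∧ j       ≈⟨ y≤x⇒x∧y≈y j≤x∨y ⟩
      j                 ∎
    below : ∀ z → z ∧ j ≈ j → j ≤ z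
    below z z∧j≈j = trans (reflexive (Eq.sym z∧j≈j)) (x∧y≤x z j)

  module _ (δ : X) where

    raise : (x : X) → Dec (x ≤ δ) → X
    raise x (yes _) = x
    raise x (no _)  = δ ∨ x

    raise-comparable : ∀ x (d : Dec (x ≤ δ)) → Comparable L δ (raise x d)
    raise-comparable x (yes x≤δ) = inj₂ x≤δ
    raise-comparable x (no _)    = inj₁ (x≤x∨y δ x)

    ≤-raise : ∀ x (d : Dec (x ≤ δ)) → x ≤ raise x d
    ≤-raise x (yes _) = ≤-refl
    ≤-raise x (no _)  = y≤x∨y δ x

    joinPrime-raise-cancel : ∀ {x y} → JoinPrime x → ¬ x ≤ δ → x ≤ δ ∨ y → x ≤ y
    joinPrime-raise-cancel x-prime x≰δ x≤δ∨y with x-prime x≤δ∨y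
    ... | inj₁ x≤δ = contradiction x≤δ x≰δ
    ... | inj₂ x≤y = x≤y

    raise-injective : ∀ {x y} → JoinPrime x → JoinPrime y →
                      (dx : Dec (x ≤ δ)) (dy : Dec (y ≤ δ)) → raise x dx ≈ raise y dy → x ≈ y
    raise-injective _ _ (yes _) (yes _) x≈y = x≈y
    raise-injective _ _ (yes x≤δ) (no y≰δ) x≈δ∨y =
      contradiction (trans (≤-raise _ (no y≰δ)) (trans (reflexive (Eq.sym x≈δ∨y)) x≤δ)) y≰δ
    raise-injective _ _ (no x≰δ) (yes y≤δ) δ∨x≈y =
      contradiction (trans (≤-raise _ (no x≰δ)) (trans (reflexive δ∨x≈y) y≤δ)) x≰δ
    raise-injective x-prime y-prime (no x≰δ) (no y≰δ) δ∨x≈δ∨y = antisym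
      (joinPrime-raise-cancel x-prime x≰δ (trans (≤-raise _ (no x≰δ)) (reflexive δ∨x≈δ∨y)))
      (joinPrime-raise-cancel y-prime y≰δ (trans (≤-raise _ (no y≰δ)) (reflexive (Eq.sym δ∨x≈δ∨y))))

mainTheorem12 : {c ℓ₁ ℓ₂ : Level} (L : DistributiveLattice c ℓ₁ ℓ₂) →
    Finite L →
    ∀ (δ : Carrier L) (nJ nδ : ℕ) →
    HasSize L (JoinIrreducible L) nJ →
    HasSize L (Comparable L δ) nδ →
    nδ ≥ nJ
mainTheorem12 L _ δ nJ nδ (js , enumJ , refl) (cs , enumC , refl) =
  decidable-stable (length js ℕ.≤? length cs) (¬¬-map count (¬¬-decide-All js))
  where
  open DistributiveLattice L using (_≈_; _≤_; setoid)
  open Enumerates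
  Labelled : Carrier L → Set _
  Labelled j = Dec (j ≤ δ) × JoinIrreducible L j
  image : ∀ {j} → Labelled j → Carrier L
  image (d , _) = raise L δ _ d
  open Reduce {P = Labelled} image
  count : All (λ j → Dec (j ≤ δ)) js → length js ℕ.≤ length cs
  count decisions = begin
    length js                      ≡⟨ length-reduce labelled ⟨
    length (reduce image labelled) ≤⟨ Unique-length≤ setoid
      (AllPairs-reduce separated labelled (distinct enumJ))
      (All-reduce (λ (d , _) → complete enumC _ (raise-comparable L δ _ d)) labelled) ⟩
    length cs                      ∎
    where
    open ≤-Reasoning
    labelled : All Labelled js
    labelled = zip (decisions , sound enumJ)
    separated : ∀ {x y} (px : Labelled x) (py : Labelled y) → ¬ x ≈ y → ¬ image px ≈ image py
    separated (dx , jx) (dy , jy) x≉y image≈ = x≉y (raise-injective L δ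
      (joinIrreducible⇒joinPrime L jx) (joinIrreducible⇒joinPrime L jy) dx dy image≈)
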